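{- Let $G$ be a (finite, simple, undirected) graph. Then $\gamma_R(G)\ge \bar{\gamma}_R(G)$.
   Context: For a graph $G$ and a vertex $v$, $N[v]$ denotes the closed neighbourhood of $v$ (the set of neighbours of $v$ together with $v$). A Roman dominating function of $G$ is a map $f\colon V(G)\to\{0,1,2\}$ such that every vertex $v$ with $f(v)=0$ has a neighbour $u$ with $f(u)=2$; its weight is $\sum_{v\in V(G)} f(v)$, and $\gamma_R(G)$ is the minimum weight of a Roman dominating function of $G$. A two neighbour packing of $G$ is a set $A\subseteq V(G)$ such that $|N[v]\cap A|\le 2$ for every $v\in V(G)$; $\bar{\gamma}_R(G)$ is the maximum size of a two neighbour packing of $G$. -}

module Defs where

open import Data.Nat using (ℕ; _+_; _≤_)
open import Data.Fin using (Fin; toℕ)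
open import Data.Fin.Subset using (Subset; _∈_; ∣_∣; _∩_)
open import Data.Bool using (Bool; true; false)
open import Data.Vec using (tabulate)
open import Data.Vec.Functional using () renaming (foldr to vfoldr)
open import Data.Product using (Σ; ∃; _×_; _,_)
open import Relation.Binary.PropositionalEquality using (_≡_)

record Graph (n : ℕ) : Set where
  field
    adj   : Fin n → Fin n → Bool
    sym   : ∀ u v → adj u v ≡ adj v u
    irrefl : ∀ v → adj v v ≡ false

open Graph public

N[_] : ∀ {n} {G : Graph n} → Fin n → Subset n
N[_] {G = G} v = tabulate λ u → isClosedNbr u
  where
  open import Data.Fin using (_≟_)
  open import Relation.Nullary using (yes; no)
  isClosedNbr : _ → Bool
  isClosedNbr u with u ≟ v
  ... | yes _ = true
  ... | no  _ = adj G v u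

closedNbhd : ∀ {n} (G : Graph n) → Fin n → Subset n
closedNbhd G v = N[_] {G = G} v

weight : ∀ {n} → (Fin n → Fin 3) → ℕ
weight f = vfoldr (λ x acc → toℕ x + acc) 0 f

IsRDF : ∀ {n} (G : Graph n) → (Fin n → Fin 3) → Set
IsRDF G f = ∀ v → toℕ (f v) ≡ 0 → ∃ λ u → (adj G v u ≡ true) × (toℕ (f u) ≡ 2)

IsRomanDominationNumber : ∀ {n} (G : Graph n) → ℕ → Set
IsRomanDominationNumber G k =
  (Σ (_ → Fin 3) λ f → IsRDF G f × weight f ≡ k) ×
  (∀ f → IsRDF G f → k ≤ weight f)

IsTwoNbrPacking : ∀ {n} (G : Graph n) → Subset n → Set
IsTwoNbrPacking G A = ∀ v → ∣ closedNbhd G v ∩ A ∣ ≤ 2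

IsTwoNbrPackingNumber : ∀ {n} (G : Graph n) → ℕ → Set
IsTwoNbrPackingNumber G m =
  (Σ (Subset _) λ A → IsTwoNbrPacking G A × ∣ A ∣ ≡ m) ×
  (∀ A → IsTwoNbrPacking G A → ∣ A ∣ ≤ m)

{-# OPTIONS --safe #-}
-- Assign to each vertex a a defender: a itself if f a ≥ 1, and otherwise a neighbour labelled
-- 2, which exists because f is Roman dominating. A vertex v labelled 0 defends nobody, one
-- labelled 1 defends only itself, and one labelled 2 defends only vertices of N[v]; so a two
-- neighbour packing A contains at most f v of the vertices defended by v. Counting A along
-- the fibres of the defender map gives ∣A∣ ≤ ∑ f v = weight f.
module Submission where

open import Defs hiding (sym)
open import Data.Nat using (ℕ; zero; suc; _+_; _≤_; z≤n)
open import Data.Nat.Properties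
  using (+-0-commutativeMonoid; +-mono-≤; ≤-reflexive; ≤-trans; 0≢1+n; module ≤-Reasoning)
open import Algebra.Properties.CommutativeMonoid.Sum +-0-commutativeMonoid
  using (sum; sum-syntax; ∑-distrib-+; sum-cong-≗; sum-replicate-zero)
open import Data.Bool using (Bool; true; false; _∧_)
open import Data.Fin using (Fin; zero; suc; toℕ; _≟_)
open import Data.Fin.Patterns using (0F; 1F; 2F)
open import Data.Fin.Subset using (Subset; _∈_; _⊆_; ∣_∣; _∩_; ⊥; ⁅_⁆)
open import Data.Fin.Subset.Properties
  using (p⊆q⇒∣p∣≤∣q∣; ∣⊥∣≡0; ∣⁅x⁆∣≡1; x∈⁅x⁆; x∈p∩q⁺; x∈p∩q⁻)
open import Data.Vec using ([]; _∷_; lookup; tabulate)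
open import Data.Vec.Properties using (lookup∘tabulate; []=⇒lookup; lookup⇒[]=)
open import Data.Product using (Σ-syntax; _×_; _,_; proj₁; proj₂)
open import Data.Sum using (_⊎_; inj₁; inj₂)
open import Relation.Nullary using (¬_; yes; no; does; contradiction)
open import Relation.Binary.PropositionalEquality
  using (_≡_; _≢_; refl; sym; trans; cong; cong₂; subst; module ≡-Reasoning)

𝟙 : Bool → ℕ
𝟙 true  = 1
𝟙 false = 0

∣b∷p∣≡𝟙b+∣p∣ : ∀ {n} b (p : Subset n) → ∣ b ∷ p ∣ ≡ 𝟙 b + ∣ p ∣
∣b∷p∣≡𝟙b+∣p∣ true  p = refl
∣b∷p∣≡𝟙b+∣p∣ false p = refl

∑-mono-≤ : ∀ {n} {f g : Fin n → ℕ} → (∀ i → f i ≤ g i) → sum f ≤ sum g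
∑-mono-≤ {zero}  f≤g = z≤n
∑-mono-≤ {suc n} f≤g = +-mono-≤ (f≤g zero) (∑-mono-≤ (λ i → f≤g (suc i)))

-- Stated with does rather than ⌊_⌋: only does (suc i ≟ suc v) reduces to does (i ≟ v).
∑-𝟙-≟ : ∀ {m} (i : Fin m) → ∑[ v < m ] 𝟙 (does (i ≟ v)) ≡ 1
∑-𝟙-≟ {suc m} zero    = cong suc (sum-replicate-zero m)
∑-𝟙-≟ {suc m} (suc i) = ∑-𝟙-≟ {m} i

∑-𝟙-∧-≟ : ∀ {m} b (i : Fin m) → ∑[ v < m ] 𝟙 (b ∧ does (i ≟ v)) ≡ 𝟙 b
∑-𝟙-∧-≟ {m} false i = sum-replicate-zero m
∑-𝟙-∧-≟     true  i = ∑-𝟙-≟ i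

preimage : ∀ {n m} → (Fin n → Fin m) → Fin m → Subset n
preimage φ v = tabulate λ a → does (φ a ≟ v)

∈-preimage⁻ : ∀ {n m} {φ : Fin n → Fin m} {v a} → a ∈ preimage φ v → φ a ≡ v
∈-preimage⁻ {φ = φ} {v} {a} a∈
  with φ a ≟ v | trans (sym (lookup∘tabulate _ a)) ([]=⇒lookup a∈)
... | yes φa≡v | _  = φa≡v
... | no  _    | ()

∣p∣≡∑∣p∩preimage∣ : ∀ {n m} (φ : Fin n → Fin m) (p : Subset n) →
                    ∣ p ∣ ≡ ∑[ v < m ] ∣ p ∩ preimage φ v ∣
∣p∣≡∑∣p∩preimage∣ {m = m} φ []      = sym (sum-replicate-zero m)
∣p∣≡∑∣p∩preimage∣ {m = m} φ (b ∷ p) = begin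
  ∣ b ∷ p ∣
    ≡⟨ ∣b∷p∣≡𝟙b+∣p∣ b p ⟩
  𝟙 b + ∣ p ∣
    ≡⟨ cong₂ _+_ (sym (∑-𝟙-∧-≟ b (φ zero))) (∣p∣≡∑∣p∩preimage∣ (λ a → φ (suc a)) p) ⟩
  ∑[ v < m ] 𝟙 (b ∧ does (φ zero ≟ v)) + ∑[ v < m ] ∣ p ∩ preimage (λ a → φ (suc a)) v ∣
    ≡⟨ sym (∑-distrib-+ (λ v → 𝟙 (b ∧ does (φ zero ≟ v))) _) ⟩
  ∑[ v < m ] (𝟙 (b ∧ does (φ zero ≟ v)) + ∣ p ∩ preimage (λ a → φ (suc a)) v ∣)
    ≡⟨ sum-cong-≗ (λ v → sym (∣b∷p∣≡𝟙b+∣p∣ (b ∧ does (φ zero ≟ v)) (p∩fibre v))) ⟩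
  ∑[ v < m ] ∣ (b ∷ p) ∩ preimage φ v ∣ ∎
  where
  open ≡-Reasoning
  p∩fibre : Fin m → Subset _
  p∩fibre v = p ∩ preimage (λ a → φ (suc a)) v

-- N[_] tests u ≟ v inside a with-function; abstracting the lookup first makes that test
-- visible in the type of lookup∘tabulate, so that the second with can split on it.
∈-closedNbhd⁺ : ∀ {n} (G : Graph n) {u v : Fin n} → u ≡ v ⊎ adj G v u ≡ true → u ∈ closedNbhd G v
∈-closedNbhd⁺ G {u} {v} u∼v with lookup (closedNbhd G v) u in lookup≡b
... | b with u ≟ v | trans (sym lookup≡b) (lookup∘tabulate _ u) | u∼v
...   | yes _   | b≡true | _             = lookup⇒[]= u _ (trans lookup≡b b≡true)
...   | no  u≢v | _      | inj₁ u≡v      = contradiction u≡v u≢v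
...   | no  _   | b≡adj  | inj₂ adjacent = lookup⇒[]= u _ (trans lookup≡b (trans b≡adj adjacent))

weight≡∑ : ∀ {n} (f : Fin n → Fin 3) → weight f ≡ ∑[ v < n ] toℕ (f v)
weight≡∑ {zero}  f = refl
weight≡∑ {suc n} f = cong (toℕ (f zero) +_) (weight≡∑ (λ a → f (suc a)))

module _ {n} (G : Graph n) (f : Fin n → Fin 3) where

  Defends : Fin n → Fin n → Set
  Defends d a = (d ≡ a × f a ≢ 0F) ⊎ (a ∈ closedNbhd G d × toℕ (f d) ≡ 2)

  IsRDF⇒defender : IsRDF G f → ∀ a → Σ[ d ∈ Fin n ] Defends d a
  IsRDF⇒defender isRDF a with f a in fa≡
  ... | suc _ = a , inj₁ (refl , λ ())
  ... | 0F    with isRDF a (cong toℕ fa≡)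
  ...   | d , a∼d , fd≡2 = d , inj₂ (∈-closedNbhd⁺ G (inj₂ (trans (Graph.sym G d a) a∼d)) , fd≡2)

  Defends⇒∈closedNbhd : ∀ {d a} → Defends d a → a ∈ closedNbhd G d
  Defends⇒∈closedNbhd (inj₁ (refl , _))  = ∈-closedNbhd⁺ G (inj₁ refl)
  Defends⇒∈closedNbhd (inj₂ (a∈N[d] , _)) = a∈N[d]

  f≡0⇒¬Defends : ∀ {d a} → f d ≡ 0F → ¬ Defends d a
  f≡0⇒¬Defends fd≡0 (inj₁ (refl , fa≢0)) = fa≢0 fd≡0
  f≡0⇒¬Defends fd≡0 (inj₂ (_ , fd≡2))    = 0≢1+n (trans (sym (cong toℕ fd≡0)) fd≡2)

  f≡1⇒Defends⇒≡ : ∀ {d a} → f d ≡ 1F → Defends d a → a ≡ d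
  f≡1⇒Defends⇒≡ fd≡1 (inj₁ (d≡a , _))  = sym d≡a
  f≡1⇒Defends⇒≡ fd≡1 (inj₂ (_ , fd≡2)) = contradiction (trans (sym (cong toℕ fd≡1)) fd≡2) λ ()

  module _ {A : Subset n} (packing : IsTwoNbrPacking G A)
           (φ : Fin n → Fin n) (φ-defends : ∀ a → Defends (φ a) a) where

    ∈fibre⇒Defends : ∀ {v a} → a ∈ A ∩ preimage φ v → Defends v a
    ∈fibre⇒Defends {v} {a} a∈fibre =
      subst (λ d → Defends d a) (∈-preimage⁻ {φ = φ} (proj₂ (x∈p∩q⁻ A _ a∈fibre))) (φ-defends a)

    ∣fibre∣≤f : ∀ v → ∣ A ∩ preimage φ v ∣ ≤ toℕ (f v)
    ∣fibre∣≤f v with f v in fv≡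
    ... | 0F = ≤-trans (p⊆q⇒∣p∣≤∣q∣ fibre⊆⊥) (≤-reflexive (∣⊥∣≡0 n))
      where
      fibre⊆⊥ : A ∩ preimage φ v ⊆ ⊥
      fibre⊆⊥ a∈ = contradiction (∈fibre⇒Defends a∈) (f≡0⇒¬Defends fv≡)
    ... | 1F = ≤-trans (p⊆q⇒∣p∣≤∣q∣ fibre⊆⁅v⁆) (≤-reflexive (∣⁅x⁆∣≡1 v))
      where
      fibre⊆⁅v⁆ : A ∩ preimage φ v ⊆ ⁅ v ⁆
      fibre⊆⁅v⁆ a∈ = subst (_∈ ⁅ v ⁆) (sym (f≡1⇒Defends⇒≡ fv≡ (∈fibre⇒Defends a∈))) (x∈⁅x⁆ v)
    ... | 2F = ≤-trans (p⊆q⇒∣p∣≤∣q∣ fibre⊆N[v]∩A) (packing v)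
      where
      fibre⊆N[v]∩A : A ∩ preimage φ v ⊆ closedNbhd G v ∩ A
      fibre⊆N[v]∩A a∈ = x∈p∩q⁺ (Defends⇒∈closedNbhd (∈fibre⇒Defends a∈) , proj₁ (x∈p∩q⁻ A _ a∈))

  ∣packing∣≤weight : IsRDF G f → ∀ {A} → IsTwoNbrPacking G A → ∣ A ∣ ≤ weight f
  ∣packing∣≤weight isRDF {A} packing = begin
    ∣ A ∣                                  ≡⟨ ∣p∣≡∑∣p∩preimage∣ defender A ⟩
    ∑[ v < n ] ∣ A ∩ preimage defender v ∣ ≤⟨ ∑-mono-≤ (∣fibre∣≤f packing defender defends) ⟩
    ∑[ v < n ] toℕ (f v)                   ≡⟨ sym (weight≡∑ f) ⟩
    weight f                               ∎
    where
    open ≤-Reasoning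
    defender : Fin n → Fin n
    defender a = proj₁ (IsRDF⇒defender isRDF a)
    defends : ∀ a → Defends (defender a) a
    defends a = proj₂ (IsRDF⇒defender isRDF a)

mainTheorem2 : ∀ (n : ℕ) (G : Graph n) (γR γ̄R : ℕ) →
    IsRomanDominationNumber G γR → IsTwoNbrPackingNumber G γ̄R → γ̄R ≤ γR
mainTheorem2 n G _ _ ((f , isRDF , refl) , _) ((A , packing , refl) , _) =
  ∣packing∣≤weight G f isRDF packing
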